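{- Let $G$ be an ultrahomogeneous vertex-colored oriented graph with exactly two vertex color classes $R$ and $B$ such that $G[R]\cong H_0$. Then $R$ and $B$ are homogeneously connected.
   Context: A vertex-colored oriented graph (finite loopless digraph, never both $(u,v)$ and $(v,u)$ arcs, with a vertex coloring) is identified with the complete colored digraph having $\zeta((u,v))=1$ if $(u,v)$ is an arc and $0$ otherwise; it is ultrahomogeneous if every color-preserving isomorphism between induced subgraphs extends to a color-preserving automorphism. A vertex color class is a maximal set of vertices of one color. $H_0$ is the oriented graph on $\{x_1,\dots,x_8\}$ with arcs $(x_i,x_j)$ for $(i,j)\in\{(1,2),(2,5),(5,6),(6,1),(3,4),(4,7),(7,8),(8,3),(1,8),(8,5),(5,4),(4,1),(3,2),(2,7),(7,6),(6,3),(2,8),(8,6),(6,4),(4,2),(7,1),(1,3),(3,5),(5,7)\}$. Disjoint sets $R,B$ are homogeneously connected if $\zeta$ is constant on $R\times B$ and constant on $B\times R$. -}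

module Defs where

open import Data.Nat using (ℕ; suc; _≡ᵇ_)
open import Data.Bool using (Bool; true; false; _∧_)
open import Data.Fin using (Fin; toℕ)
open import Data.List using (List; []; _∷_)
open import Data.Bool.ListAction using (any)
open import Data.Product using (Σ; _×_; _,_; ∃)
open import Function.Bundles using (_↔_; Inverse)
open import Function.Definitions using (Injective)
open import Relation.Binary.PropositionalEquality using (_≡_)

record ColoredOrientedGraph (n : ℕ) (C : Set) : Set where
  field
    arc    : Fin n → Fin n → Bool
    colour : Fin n → C
    loopless : ∀ v → arc v v ≡ false
    oriented : ∀ u v → arc u v ≡ true → arc v u ≡ false
open ColoredOrientedGraph public

-- A colour-preserving isomorphism between induced subgraphs, given by
-- enumerating its domain: a i ↦ b i (a, b injective).
IsPartialIso : ∀ {n C} → ColoredOrientedGraph n C → ∀ {k} → (Fin k → Fin n) → (Fin k → Fin n) → Set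
IsPartialIso G a b =
  Injective _≡_ _≡_ a × Injective _≡_ _≡_ b ×
  (∀ i → colour G (a i) ≡ colour G (b i)) ×
  (∀ i j → arc G (a i) (a j) ≡ arc G (b i) (b j))

IsAutomorphism : ∀ {n C} → ColoredOrientedGraph n C → (Fin n ↔ Fin n) → Set
IsAutomorphism G σ =
  (∀ v → colour G (Inverse.to σ v) ≡ colour G v) ×
  (∀ u v → arc G (Inverse.to σ u) (Inverse.to σ v) ≡ arc G u v)

Ultrahomogeneous : ∀ {n C} → ColoredOrientedGraph n C → Set
Ultrahomogeneous {n} G =
  ∀ k (a b : Fin k → Fin n) → IsPartialIso G a b →
  Σ (Fin n ↔ Fin n) λ σ → IsAutomorphism G σ × (∀ i → Inverse.to σ (a i) ≡ b i)

-- H₀ on {x₁,…,x₈}; vertex x_i is (i-1) : Fin 8.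
H₀arcs : List (ℕ × ℕ)
H₀arcs =
  (1 , 2) ∷ (2 , 5) ∷ (5 , 6) ∷ (6 , 1) ∷ (3 , 4) ∷ (4 , 7) ∷ (7 , 8) ∷ (8 , 3) ∷
  (1 , 8) ∷ (8 , 5) ∷ (5 , 4) ∷ (4 , 1) ∷ (3 , 2) ∷ (2 , 7) ∷ (7 , 6) ∷ (6 , 3) ∷
  (2 , 8) ∷ (8 , 6) ∷ (6 , 4) ∷ (4 , 2) ∷ (7 , 1) ∷ (1 , 3) ∷ (3 , 5) ∷ (5 , 7) ∷ []

H₀ : Fin 8 → Fin 8 → Bool
H₀ i j = any (λ { (p , q) → (suc (toℕ i) ≡ᵇ p) ∧ (suc (toℕ j) ≡ᵇ q) }) H₀arcs

InducedIsoH₀ : ∀ {n C} → ColoredOrientedGraph n C → C → Set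
InducedIsoH₀ {n} G c =
  Σ (Fin 8 → Fin n) λ h →
    Injective _≡_ _≡_ h ×
    (∀ i → colour G (h i) ≡ c) ×
    (∀ v → colour G v ≡ c → ∃ λ i → h i ≡ v) ×
    (∀ i j → arc G (h i) (h j) ≡ H₀ i j)

HomogeneouslyConnected : ∀ {n C} → ColoredOrientedGraph n C → C → C → Set
HomogeneouslyConnected G r s =
  (∃ λ β → ∀ u v → colour G u ≡ r → colour G v ≡ s → arc G u v ≡ β) ×
  (∃ λ β → ∀ u v → colour G u ≡ r → colour G v ≡ s → arc G v u ≡ β)

{-# OPTIONS --safe #-}
module Submission where

-- Fix a blue vertex b and colour every red vertex x by its link (arc b x , arc x b), which takes
-- one of three values.  Automorphisms of G fixing b preserve R and this colouring, so by
-- ultrahomogeneity H₀ with this colouring has the one-point extension property.  Nineteen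
-- instances of that property, each checked on H₀, rule out all non-constant colourings among the
-- 3⁸ candidates: every blue vertex is linked to all of R in the same way.  Finally an
-- automorphism carrying one blue vertex to another maps R onto itself, so all blue vertices
-- share the same link.

open import Defs
open import Data.Nat using (ℕ; zero; suc)
open import Data.Bool using (Bool; true; false)
import Data.Bool.Properties as Bool
open import Data.Unit using (⊤; tt)
import Data.Unit.Properties as Unit
open import Data.Fin using (Fin; zero; suc)
open import Data.Fin.Patterns using (0F; 1F; 2F; 3F; 4F; 5F; 6F; 7F)
import Data.Fin.Properties as Fin
open import Data.Fin.Properties using (all?)
open import Data.List using (List; []; _∷_; [_]; cartesianProductWith)
open import Data.List.Membership.Propositional using (_∈_)
open import Data.List.Relation.Unary.All as All using (All)
open import Data.List.Relation.Unary.Any as Any using (Any; here; there)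
open import Data.List.Relation.Unary.Any.Properties using (cartesianProductWith⁺)
open import Data.Vec using (Vec; []; _∷_; lookup; tabulate)
open import Data.Vec.Properties using (lookup∘tabulate)
open import Data.Vec.Functional as Vector using (Vector)
open import Data.Product using (∃; _×_; _,_; proj₁; proj₂)
open import Data.Product.Properties using (≡-dec)
open import Function.Base using (_∘_)
open import Function.Bundles using (_↔_; Inverse; Injection)
open import Function.Definitions using (Injective)
open import Function.Properties.Inverse using (↔⇒↣)
open import Relation.Binary.Definitions using (DecidableEquality)
open import Relation.Nullary.Negation using (contradiction)
open import Relation.Nullary.Decidable using (Dec; map′; from-yes; ¬?; _×-dec_; _→-dec_)
open import Relation.Binary.PropositionalEquality
  using (_≡_; _≢_; refl; sym; trans; cong; cong₂; subst; module ≡-Reasoning)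

open Inverse using (to)
open ≡-Reasoning

private
  variable
    k m n : ℕ
    A C : Set

Link : Set
Link = Bool × Bool

_≟-link_ : DecidableEquality Link
_≟-link_ = ≡-dec Bool._≟_ Bool._≟_

link : ColoredOrientedGraph n C → Fin n → Fin n → Link
link G u v = arc G u v , arc G v u

links : List Link
links = (false , false) ∷ (true , false) ∷ (false , true) ∷ []

link∈links : (G : ColoredOrientedGraph n C) (u v : Fin n) → link G u v ∈ links
link∈links G u v with arc G u v in uv | arc G v u in vu
... | false | false = here refl
... | true  | false = there (here refl)
... | false | true  = there (there (here refl))
... | true  | true  = contradiction (trans (sym vu) (oriented G u v uv)) λ ()

link-automorphism : (G : ColoredOrientedGraph n C) (σ : Fin n ↔ Fin n) →
                    IsAutomorphism G σ → ∀ u v → link G (to σ u) (to σ v) ≡ link G u v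
link-automorphism G σ (_ , σ-arc) u v = cong₂ _,_ (σ-arc u v) (σ-arc v u)

injective-Fin1 : (f : Fin 1 → A) → Injective _≡_ _≡_ f
injective-Fin1 f {zero} {zero} _ = refl

singleton-partialIso : (G : ColoredOrientedGraph n C) {u v : Fin n} → colour G u ≡ colour G v →
                       IsPartialIso G (λ (_ : Fin 1) → u) (λ _ → v)
singleton-partialIso G {u} {v} same = injective-Fin1 _ , injective-Fin1 _ , (λ _ → same) ,
  (λ _ _ → trans (loopless G u) (sym (loopless G v)))

injective-∷ : {f : Vector A k} {x : A} → Injective _≡_ _≡_ f → (∀ i → f i ≢ x) →
              Injective _≡_ _≡_ (x Vector.∷ f)
injective-∷ f-inj x∉f {zero}  {zero}  _ = refl
injective-∷ f-inj x∉f {zero}  {suc j} e = contradiction (sym e) (x∉f j)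
injective-∷ f-inj x∉f {suc i} {zero}  e = contradiction e (x∉f i)
injective-∷ f-inj x∉f {suc i} {suc j} e = cong suc (f-inj e)

injective? : (f : Fin k → Fin m) → Dec (Injective _≡_ _≡_ f)
injective? f = map′ (λ inj {i} {j} → inj i j) (λ inj i j → inj)
  (all? λ i → all? λ j → f i Fin.≟ f j →-dec i Fin.≟ j)

isPartialIso? : DecidableEquality C → (K : ColoredOrientedGraph m C) (a a' : Fin k → Fin m) →
                Dec (IsPartialIso K a a')
isPartialIso? _≟_ K a a' =
  injective? a ×-dec injective? a' ×-dec
  all? (λ i → colour K (a i) ≟ colour K (a' i)) ×-dec
  all? (λ i → all? λ j → arc K (a i) (a j) Bool.≟ arc K (a' i) (a' j))

OnePointExtension : ColoredOrientedGraph m C → Set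
OnePointExtension {m} K =
  ∀ {k} (a a' : Fin k → Fin m) → IsPartialIso K a a' →
  ∀ z → (∀ i → a i ≢ z) → ∃ λ w → IsPartialIso K (z Vector.∷ a) (w Vector.∷ a')

module ColourClass (G : ColoredOrientedGraph n C) (homogeneous : Ultrahomogeneous G)
  {c : C} {h : Fin m → Fin n} (h-injective : Injective _≡_ _≡_ h)
  (h-colour : ∀ i → colour G (h i) ≡ c) (h-onto : ∀ v → colour G v ≡ c → ∃ λ i → h i ≡ v)
  where

  automorphism-preservesClass : (σ : Fin n ↔ Fin n) → IsAutomorphism G σ →
                                ∀ i → ∃ λ j → h j ≡ to σ (h i)
  automorphism-preservesClass σ (σ-colour , _) i = h-onto _ (trans (σ-colour (h i)) (h-colour i))

  link-transfer : ∀ {b b'} → colour G b ≡ colour G b' →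
                  ∀ i → ∃ λ j → link G b' (h j) ≡ link G b (h i)
  link-transfer {b} {b'} same i with homogeneous 1 _ _ (singleton-partialIso G same)
  ... | σ , σ-aut , σ-b with automorphism-preservesClass σ σ-aut i
  ... | j , hj = j , (begin
      link G b' (h j)                ≡⟨ cong₂ (link G) (sym (σ-b 0F)) hj ⟩
      link G (to σ b) (to σ (h i))   ≡⟨ link-automorphism G σ σ-aut b (h i) ⟩
      link G b (h i)                 ∎)

  module LinkColouring {b} (b∉class : colour G b ≢ c) (K : ColoredOrientedGraph m Link)
    (K-arc : ∀ i j → arc K i j ≡ arc G (h i) (h j))
    (K-colour : ∀ i → colour K i ≡ link G b (h i))
    where

    h≢b : ∀ i → h i ≢ b
    h≢b i hi≡b = b∉class (subst (λ v → colour G v ≡ c) hi≡b (h-colour i))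

    partialIso-lift : {a a' : Fin k → Fin m} → IsPartialIso K a a' →
                      IsPartialIso G (b Vector.∷ h ∘ a) (b Vector.∷ h ∘ a')
    partialIso-lift {a = a} {a'} (a-inj , a'-inj , a-colour , a-arc) =
      injective-∷ (a-inj ∘ h-injective) (h≢b ∘ a) ,
      injective-∷ (a'-inj ∘ h-injective) (h≢b ∘ a') ,
      colours , arcs
      where
      links≡ : ∀ i → link G b (h (a i)) ≡ link G b (h (a' i))
      links≡ i = trans (sym (K-colour (a i))) (trans (a-colour i) (K-colour (a' i)))
      colours : ∀ i → colour G ((b Vector.∷ h ∘ a) i) ≡ colour G ((b Vector.∷ h ∘ a') i)
      colours zero    = refl
      colours (suc i) = trans (h-colour (a i)) (sym (h-colour (a' i)))
      arcs : ∀ i j → arc G ((b Vector.∷ h ∘ a) i) ((b Vector.∷ h ∘ a) j)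
                   ≡ arc G ((b Vector.∷ h ∘ a') i) ((b Vector.∷ h ∘ a') j)
      arcs zero    zero    = refl
      arcs zero    (suc j) = cong proj₁ (links≡ j)
      arcs (suc i) zero    = cong proj₂ (links≡ i)
      arcs (suc i) (suc j) = trans (sym (K-arc (a i) (a j))) (trans (a-arc i j) (K-arc (a' i) (a' j)))

    partialIso-restrict : (σ : Fin n ↔ Fin n) {f f' : Fin k → Fin m} →
                          IsAutomorphism G σ → to σ b ≡ b → Injective _≡_ _≡_ f →
                          (∀ x → to σ (h (f x)) ≡ h (f' x)) → IsPartialIso K f f'
    partialIso-restrict σ {f} {f'} σ-aut σ-b f-inj σhf≡hf' =
      f-inj , f'-inj , colours , arcs
      where
      f'-inj : Injective _≡_ _≡_ f'
      f'-inj {x} {y} e = f-inj (h-injective (Injection.injective (↔⇒↣ σ)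
        (trans (σhf≡hf' x) (trans (cong h e) (sym (σhf≡hf' y))))))
      colours : ∀ x → colour K (f x) ≡ colour K (f' x)
      colours x = begin
        colour K (f x)                    ≡⟨ K-colour (f x) ⟩
        link G b (h (f x))                ≡⟨ link-automorphism G σ σ-aut b (h (f x)) ⟨
        link G (to σ b) (to σ (h (f x)))  ≡⟨ cong₂ (link G) σ-b (σhf≡hf' x) ⟩
        link G b (h (f' x))               ≡⟨ K-colour (f' x) ⟨
        colour K (f' x)                   ∎
      arcs : ∀ x y → arc K (f x) (f y) ≡ arc K (f' x) (f' y)
      arcs x y = begin
        arc K (f x) (f y)                    ≡⟨ K-arc (f x) (f y) ⟩
        arc G (h (f x)) (h (f y))            ≡⟨ proj₂ σ-aut (h (f x)) (h (f y)) ⟨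
        arc G (to σ (h (f x))) (to σ (h (f y)))  ≡⟨ cong₂ (arc G) (σhf≡hf' x) (σhf≡hf' y) ⟩
        arc G (h (f' x)) (h (f' y))          ≡⟨ K-arc (f' x) (f' y) ⟨
        arc K (f' x) (f' y)                  ∎

    onePointExtension : OnePointExtension K
    onePointExtension a a' a↦a' z z∉a with homogeneous _ _ _ (partialIso-lift a↦a')
    ... | σ , σ-aut , σ-maps with automorphism-preservesClass σ σ-aut z
    ... | w , hw = w , partialIso-restrict σ σ-aut (σ-maps zero) (injective-∷ (proj₁ a↦a') z∉a)
      λ { zero → sym hw ; (suc i) → σ-maps (suc i) }

H₀-loopless : ∀ v → H₀ v v ≡ false
H₀-loopless = from-yes (all? λ v → H₀ v v Bool.≟ false)

H₀-oriented : ∀ u v → H₀ u v ≡ true → H₀ v u ≡ false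
H₀-oriented = from-yes (all? λ u → all? λ v → H₀ u v Bool.≟ true →-dec H₀ v u Bool.≟ false)

H₀-coloured : (Fin 8 → C) → ColoredOrientedGraph 8 C
H₀-coloured t = record
  { arc = H₀ ; colour = t ; loopless = H₀-loopless ; oriented = H₀-oriented }

H₀-uncoloured : ColoredOrientedGraph 8 ⊤
H₀-uncoloured = H₀-coloured (λ _ → tt)

record Rule : Set where
  constructor rule
  field
    {size}     : ℕ
    source     : Vec (Fin 8) size
    target     : Vec (Fin 8) size
    point      : Fin 8
    candidates : List (Fin 8)

ValidRule : Rule → Set
ValidRule (rule xs xs' z cs) =
  IsPartialIso H₀-uncoloured (lookup xs) (lookup xs') × (∀ i → lookup xs i ≢ z) ×
  (∀ w → IsPartialIso H₀-uncoloured (z Vector.∷ lookup xs) (w Vector.∷ lookup xs') → w ∈ cs)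

validRule? : (r : Rule) → Dec (ValidRule r)
validRule? (rule xs xs' z cs) =
  isPartialIso? Unit._≟_ H₀-uncoloured (lookup xs) (lookup xs') ×-dec
  all? (λ i → ¬? (lookup xs i Fin.≟ z)) ×-dec
  all? (λ w → isPartialIso? Unit._≟_ H₀-uncoloured (z Vector.∷ lookup xs) (w Vector.∷ lookup xs')
              →-dec Any.any? (w Fin.≟_) cs)

RuleHolds : (Fin 8 → C) → Rule → Set
RuleHolds t (rule xs xs' z cs) =
  (∀ i → t (lookup xs i) ≡ t (lookup xs' i)) → Any (λ c → t z ≡ t c) cs

ruleHolds? : DecidableEquality C → (t : Fin 8 → C) (r : Rule) → Dec (RuleHolds t r)
ruleHolds? _≟_ t (rule xs xs' z cs) =
  all? (λ i → t (lookup xs i) ≟ t (lookup xs' i)) →-dec Any.any? (λ c → t z ≟ t c) cs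

extension⇒ruleHolds : (t : Fin 8 → C) → OnePointExtension (H₀-coloured t) →
                      ∀ {r} → ValidRule r → RuleHolds t r
extension⇒ruleHolds t extend {rule xs xs' z cs}
                    ((xs-inj , xs'-inj , _ , xs-arc) , z∉xs , extensions⊆cs) agree
  with extend (lookup xs) (lookup xs') (xs-inj , xs'-inj , agree , xs-arc) z z∉xs
... | w , (zxs-inj , wxs'-inj , colours , arcs) =
  Any.map (λ { refl → colours zero }) (extensions⊆cs w (zxs-inj , wxs'-inj , (λ _ → refl) , arcs))

-- Found by a greedy search among the valid rules with at most two source points.
rules : List Rule
rules =
  rule (0F ∷ []) (1F ∷ []) 4F [ 5F ] ∷
  rule (4F ∷ []) (5F ∷ []) 0F [ 1F ] ∷
  rule (0F ∷ 3F ∷ []) (6F ∷ 3F ∷ []) 1F [ 0F ] ∷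
  rule (1F ∷ 3F ∷ []) (6F ∷ 3F ∷ []) 0F [ 1F ] ∷
  rule (2F ∷ []) (4F ∷ []) 6F [ 0F ] ∷
  rule (0F ∷ 3F ∷ []) (1F ∷ 3F ∷ []) 2F [ 4F ] ∷
  rule (2F ∷ []) (5F ∷ []) 6F [ 1F ] ∷
  rule (0F ∷ []) (3F ∷ []) 4F [ 7F ] ∷
  rule (4F ∷ []) (7F ∷ []) 0F [ 3F ] ∷
  rule (0F ∷ 1F ∷ []) (2F ∷ 1F ∷ []) 2F [ 3F ] ∷
  rule (1F ∷ 2F ∷ []) (1F ∷ 3F ∷ []) 0F [ 2F ] ∷
  rule (6F ∷ []) (7F ∷ []) 2F [ 3F ] ∷
  rule (0F ∷ 1F ∷ []) (3F ∷ 1F ∷ []) 6F [ 4F ] ∷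
  rule (0F ∷ []) (5F ∷ []) 4F [ 1F ] ∷
  rule (0F ∷ []) (4F ∷ []) 1F (3F ∷ 5F ∷ 6F ∷ []) ∷
  rule (1F ∷ []) (5F ∷ []) 0F (4F ∷ 6F ∷ 7F ∷ []) ∷
  rule (2F ∷ []) (6F ∷ []) 0F (1F ∷ 3F ∷ 4F ∷ []) ∷
  rule (3F ∷ []) (7F ∷ []) 0F (2F ∷ 4F ∷ 5F ∷ []) ∷
  rule (0F ∷ 1F ∷ []) (0F ∷ 7F ∷ []) 2F [ 1F ] ∷
  []

rules-valid : All ValidRule rules
rules-valid = from-yes (All.all? validRule? rules)

vectorsOver : List A → (n : ℕ) → List (Vec A n)
vectorsOver xs zero    = [ [] ]
vectorsOver xs (suc n) = cartesianProductWith _∷_ xs (vectorsOver xs n)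

∈-vectorsOver : {xs : List A} (v : Vec A n) → (∀ i → lookup v i ∈ xs) → v ∈ vectorsOver xs n
∈-vectorsOver []      _  = here refl
∈-vectorsOver (x ∷ v) v⊆xs =
  cartesianProductWith⁺ _∷_ (λ { refl refl → refl }) (v⊆xs zero) (∈-vectorsOver v (v⊆xs ∘ suc))

Constant : (Fin (suc n) → A) → Set
Constant t = ∀ i → t i ≡ t zero

rulesForceConstant : All (λ v → All (RuleHolds (lookup v)) rules → Constant (lookup v))
                         (vectorsOver links 8)
rulesForceConstant = from-yes (All.all?
  (λ v → All.all? (ruleHolds? _≟-link_ (lookup v)) rules →-dec
         all? λ i → lookup v i ≟-link lookup v 0F)
  (vectorsOver links 8))

extension⇒constant : (v : Vec Link 8) → (∀ i → lookup v i ∈ links) →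
                     OnePointExtension (H₀-coloured (lookup v)) → Constant (lookup v)
extension⇒constant v v⊆links extend =
  All.lookup rulesForceConstant (∈-vectorsOver v v⊆links)
    (All.map (λ {r} → extension⇒ruleHolds (lookup v) extend {r}) rules-valid)

module H₀Class (G : ColoredOrientedGraph n Bool) (homogeneous : Ultrahomogeneous G)
  {h : Fin 8 → Fin n} (h-injective : Injective _≡_ _≡_ h)
  (h-red : ∀ i → colour G (h i) ≡ true) (h-onto : ∀ v → colour G v ≡ true → ∃ λ i → h i ≡ v)
  (h-arc : ∀ i j → arc G (h i) (h j) ≡ H₀ i j)
  where

  open ColourClass G homogeneous h-injective h-red h-onto

  blue-link-constant : ∀ {b} → colour G b ≡ false → ∀ i → link G b (h i) ≡ link G b (h 0F)
  blue-link-constant {b} b-blue i = begin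
    link G b (h i)   ≡⟨ lookup∘tabulate (link G b ∘ h) i ⟨
    lookup v i       ≡⟨ extension⇒constant v v⊆links onePointExtension i ⟩
    lookup v 0F      ≡⟨ lookup∘tabulate (link G b ∘ h) 0F ⟩
    link G b (h 0F)  ∎
    where
    v = tabulate (link G b ∘ h)
    v⊆links : ∀ i → lookup v i ∈ links
    v⊆links i = subst (_∈ links) (sym (lookup∘tabulate (link G b ∘ h) i)) (link∈links G b (h i))
    open LinkColouring (λ b-red → contradiction (trans (sym b-blue) b-red) λ ())
      (H₀-coloured (lookup v)) (λ i j → sym (h-arc i j)) (lookup∘tabulate (link G b ∘ h))

  link-uniform : ∀ {u v b₀} → colour G u ≡ true → colour G v ≡ false → colour G b₀ ≡ false →
                 link G v u ≡ link G b₀ (h 0F)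
  link-uniform {v = v} {b₀} u-red v-blue b₀-blue
    with h-onto _ u-red | link-transfer (trans b₀-blue (sym v-blue)) 0F
  ... | i , refl | j , vj≡b₀0 = begin
    link G v (h i)    ≡⟨ blue-link-constant v-blue i ⟩
    link G v (h 0F)   ≡⟨ blue-link-constant v-blue j ⟨
    link G v (h j)    ≡⟨ vj≡b₀0 ⟩
    link G b₀ (h 0F)  ∎

mainTheorem15 : (n : ℕ) (G : ColoredOrientedGraph n Bool) →
    Ultrahomogeneous G →
    (∃ λ u → colour G u ≡ true) → (∃ λ v → colour G v ≡ false) →
    InducedIsoH₀ G true →
    HomogeneouslyConnected G true false
mainTheorem15 n G homogeneous _ (b₀ , b₀-blue) (h , h-injective , h-red , h-onto , h-arc) =
    (proj₂ (link G b₀ (h 0F)) , λ u v u-red v-blue → cong proj₂ (link-uniform u-red v-blue b₀-blue))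
  , (proj₁ (link G b₀ (h 0F)) , λ u v u-red v-blue → cong proj₁ (link-uniform u-red v-blue b₀-blue))
  where open H₀Class G homogeneous h-injective h-red h-onto h-arc
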